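{- Let $I(n,k)$ be defined as in the context and let $J(n,k):=2^k(n+k-1)!\,I(n,k)$. Then for all $k\ge0$: $J(1,k)=1$, and $\sum_{k\ge0}J(1,k)x^k=\frac{1}{1-x}$; $J(2,k)=4^k-2^{k-1}$, and $\sum_{k\ge0}J(2,k)x^k=\frac{1/2}{(1-2x)(1-4x)}$; $J(3,k)=-\frac{25}{8}\,5^k+\frac34\,3^k+\frac{27}{8}\,9^k$, and $\sum_{k\ge0}J(3,k)x^k=\frac{1}{(1-3x)(1-5x)(1-9x)}$; $J(4,k)=\frac{64}{3}\,16^k+\frac{27}{2}\,6^k-\frac{250}{12}\,10^k-2\cdot4^k-8\cdot8^k$, and $\sum_{k\ge0}J(4,k)x^k=\frac{4-34x}{(1-4x)(1-6x)(1-8x)(1-10x)(1-16x)}$.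
   Context: The numbers $I(n,k)$ are defined recursively by: $I(n,k)=0$ if $k<0$ or $n<1$; $I(1,0)=1$; and for all $n\ge1$, $k\ge0$ with $(n,k)\neq(1,0)$, $$I(n,k)=\frac{1}{2(n+k-1)}\left(n^2 I(n,k-1)+\sum_{i=1}^{n-1}\sum_{j=0}^{k} i(n-i)\,I(i,j)\,I(n-i,k-j)\right).$$ (Combinatorially, $I(n,k)$ is the sum of the inverses of the orders of the automorphism groups of all pairwise non-isomorphic connected multigraphs, loops and multiple edges allowed, on $n$ vertices with cyclomatic number $k$.) -}

module Defs where

open import Data.Nat as ℕ using (ℕ; zero; suc; _∸_; _!)
open import Data.Integer as ℤ using (+_; -[1+_])
open import Data.Rational using (ℚ; 0ℚ; 1ℚ; _+_; _*_; _-_; -_; _/_)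
open import Data.List using (List; []; _∷_)
open import Relation.Binary.PropositionalEquality using (_≡_)

ℕ→ℚ : ℕ → ℚ
ℕ→ℚ n = (+ n) / 1

_^ℚ_ : ℚ → ℕ → ℚ
p ^ℚ zero = 1ℚ
p ^ℚ suc k = p * (p ^ℚ k)

-- Σ[ a , b ] f  =  f a + f (a+1) + ... + f b   (empty, i.e. 0, if b < a)
Σ[_,_] : ℕ → ℕ → (ℕ → ℚ) → ℚ
Σ[ a , b ] f = go (suc b ∸ a) a
  where
  go : ℕ → ℕ → ℚ
  go zero    _ = 0ℚ
  go (suc c) i = f i + go c (suc i)

-- The recursion for I(n,k), with a fuel parameter guaranteeing termination.
-- Every recursive call on the right-hand side of the defining recursion is at
-- a pair (n',k') with n'+k' < n+k, so fuel n+k+1 always suffices (see I below).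
-- Cases: n = 0 gives 0 (n < 1); (1,0) gives 1; otherwise the recursion, where
-- I(n,k-1) is 0 when k = 0 (k-1 < 0).
I-fuel : ℕ → ℕ → ℕ → ℚ
I-fuel zero    _                 _ = 0ℚ
I-fuel (suc f) zero              _ = 0ℚ
I-fuel (suc f) (suc zero)        zero = 1ℚ
I-fuel (suc f) (suc zero)        (suc k') =
  let n = 1 ; k = suc k' in
  ((+ 1) / (2 ℕ.* (n ℕ.+ k ∸ 1))) *
    ( ℕ→ℚ (n ℕ.* n) * I-fuel f n k'
    + Σ[ 1 , n ∸ 1 ] (λ i → Σ[ 0 , k ] (λ j →
        ℕ→ℚ (i ℕ.* (n ∸ i)) * I-fuel f i j * I-fuel f (n ∸ i) (k ∸ j))))
I-fuel (suc f) (suc (suc n'')) k =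
  let n = suc (suc n'') in
  ((+ 1) / (2 ℕ.* (n ℕ.+ k ∸ 1))) *
    ( ℕ→ℚ (n ℕ.* n) * prev k
    + Σ[ 1 , n ∸ 1 ] (λ i → Σ[ 0 , k ] (λ j →
        ℕ→ℚ (i ℕ.* (n ∸ i)) * I-fuel f i j * I-fuel f (n ∸ i) (k ∸ j))))
  where
  prev : ℕ → ℚ
  prev zero     = 0ℚ
  prev (suc k') = I-fuel f (suc (suc n'')) k'

I : ℕ → ℕ → ℚ
I n k = I-fuel (suc (n ℕ.+ k)) n k

J : ℕ → ℕ → ℚ
J n k = ℕ→ℚ (2 ℕ.^ k) * ℕ→ℚ ((n ℕ.+ k ∸ 1) !) * I n k

Series : Set
Series = ℕ → ℚ

infixl 7 _⊛_
_⊛_ : Series → Series → Series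
(F ⊛ G) m = Σ[ 0 , m ] (λ i → F i * G (m ∸ i))

poly : List ℚ → Series
poly []       _       = 0ℚ
poly (c ∷ cs) zero    = c
poly (c ∷ cs) (suc m) = poly cs m

1-_x : ℚ → Series
1- c x = poly (1ℚ ∷ (- c) ∷ [])

infix 4 _≗ₛ_
_≗ₛ_ : Series → Series → Set
F ≗ₛ G = ∀ m → F m ≡ G m

Jseries : ℕ → Series
Jseries n k = J n k

-- Write E_e(m) = e^m/m!. For each n ≤ 4 we exhibit a finite combination
-- L_n = Σ b·E_e with  I(n,k) = L_n(n-1+k)  and  L_n(m) = 0 for m < n-1.
-- Such combinations are closed under the Cauchy product, since E_a ⋆ E_b =
-- E_{a+b} (binomial theorem), and under the shift m ↦ m+1, since
-- (m+1)·E_e(m+1) = e·E_e(m). So the defining recursion of I, read at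
-- m = n-2+k, becomes an identity between finite combinations, which is decided
-- by comparing normal forms (sorted by exponent, merged, zeros removed).
-- Multiplying by 2^k (n+k-1)! turns each b·E_e into the geometric sequence
-- b·e^(n-1)·(2e)^k, which gives J; the product of the stated denominator with
-- such a sequence is a polynomial, again decided by normal forms.
module Submission where

open import Defs
open import Data.Nat using (ℕ)
open import Data.Integer using (+_; -[1+_])
open import Data.Rational using (ℚ; 1ℚ; _+_; _*_; _-_; -_; _/_)
open import Data.List using (List; []; _∷_)
open import Data.Product using (_×_)
open import Relation.Binary.PropositionalEquality using (_≡_)

open import Data.Nat as ℕ using (zero; suc; _∸_; _!; _≤_; _<_; z≤n; s≤s)
import Data.Nat.Properties as ℕₚ
import Data.Integer as ℤ
import Data.Integer.Properties as ℤₚ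
open import Data.Rational using (mkℚ; 0ℚ)
import Data.Rational as ℚ
import Data.Rational.Properties as ℚₚ
import Data.Nat.Coprimality as Coprimality
open import Data.Product using (_,_)
open import Data.List using (_++_; length; drop; foldl)
open import Data.List.Properties using (∷-injectiveˡ; ∷-injectiveʳ)
open import Relation.Binary.PropositionalEquality
  using (refl; sym; trans; cong; cong₂; subst; module ≡-Reasoning)
open import Relation.Nullary using (yes; no)
open import Data.Rational.Solver using (module +-*-Solver)
open +-*-Solver using (solve; _:+_; _:*_; _:-_; _:=_; con)

open ≡-Reasoning

sumFrom : (ℕ → ℚ) → ℕ → ℕ → ℚ
sumFrom f zero    i = 0ℚ
sumFrom f (suc c) i = f i + sumFrom f c (suc i)

suc-+-∸ : ∀ a c → suc (a ℕ.+ c) ∸ a ≡ suc c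
suc-+-∸ zero    c = refl
suc-+-∸ (suc a) c = suc-+-∸ a c

-- The sums Σ[ a , b ] of Defs are sumFrom sums. Σ[ a , b ] unfolds only once
-- suc b ∸ a is visibly a successor; the with-abstractions expose it.
Σ-sumFrom : ∀ f a c → Σ[ a , a ℕ.+ c ] f ≡ sumFrom f (suc c) a
Σ-sumFrom f a c with suc (a ℕ.+ c) ∸ a | suc-+-∸ a c
Σ-sumFrom f a zero    | _ | refl = refl
Σ-sumFrom f a (suc c) | _ | refl with suc (a ℕ.+ c) ∸ a | suc-+-∸ a c | Σ-sumFrom f (suc a) c
... | _ | refl | rest = cong (_+_ (f a)) rest

sumFrom-cong : ∀ {f g} c i → (∀ r → i ≤ r → r < c ℕ.+ i → f r ≡ g r) →
               sumFrom f c i ≡ sumFrom g c i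
sumFrom-cong zero    i eq = refl
sumFrom-cong (suc c) i eq =
  cong₂ _+_ (eq i ℕₚ.≤-refl (s≤s (ℕₚ.m≤n+m i c)))
            (sumFrom-cong c (suc i) λ r i<r r< →
              eq r (ℕₚ.<⇒≤ i<r) (subst (r <_) (ℕₚ.+-suc c i) r<))

sumFrom-cong′ : ∀ {f g} c i → (∀ r → f r ≡ g r) → sumFrom f c i ≡ sumFrom g c i
sumFrom-cong′ c i eq = sumFrom-cong c i (λ r _ _ → eq r)

Σ-cong : ∀ {f g} a c → (∀ r → a ≤ r → r ≤ a ℕ.+ c → f r ≡ g r) →
         Σ[ a , a ℕ.+ c ] f ≡ Σ[ a , a ℕ.+ c ] g
Σ-cong {f} {g} a c eq = begin
  Σ[ a , a ℕ.+ c ] f  ≡⟨ Σ-sumFrom f a c ⟩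
  sumFrom f (suc c) a ≡⟨ sumFrom-cong (suc c) a (λ r a≤r r< →
                           eq r a≤r (subst (r ≤_) (ℕₚ.+-comm c a) (ℕₚ.≤-pred r<))) ⟩
  sumFrom g (suc c) a ≡⟨ Σ-sumFrom g a c ⟨
  Σ[ a , a ℕ.+ c ] g  ∎

sumFrom-shift : ∀ f c i → sumFrom f c (suc i) ≡ sumFrom (λ r → f (suc r)) c i
sumFrom-shift f zero    i = refl
sumFrom-shift f (suc c) i = cong (_+_ (f (suc i))) (sumFrom-shift f c (suc i))

sumFrom-+ : ∀ f g c i → sumFrom (λ r → f r + g r) c i ≡ sumFrom f c i + sumFrom g c i
sumFrom-+ f g zero    i = refl
sumFrom-+ f g (suc c) i = begin
  (f i + g i) + sumFrom (λ r → f r + g r) c (suc i)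
    ≡⟨ cong (_+_ (f i + g i)) (sumFrom-+ f g c (suc i)) ⟩
  (f i + g i) + (sumFrom f c (suc i) + sumFrom g c (suc i))
    ≡⟨ solve 4 (λ a b x y → (a :+ b) :+ (x :+ y) := (a :+ x) :+ (b :+ y)) refl
         (f i) (g i) (sumFrom f c (suc i)) (sumFrom g c (suc i)) ⟩
  (f i + sumFrom f c (suc i)) + (g i + sumFrom g c (suc i)) ∎

sumFrom-scale : ∀ a f c i → sumFrom (λ r → a * f r) c i ≡ a * sumFrom f c i
sumFrom-scale a f zero    i = sym (ℚₚ.*-zeroʳ a)
sumFrom-scale a f (suc c) i =
  trans (cong (_+_ (a * f i)) (sumFrom-scale a f c (suc i)))
        (sym (ℚₚ.*-distribˡ-+ a (f i) (sumFrom f c (suc i))))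

sumFrom-zero : ∀ c i → sumFrom (λ _ → 0ℚ) c i ≡ 0ℚ
sumFrom-zero zero    i = refl
sumFrom-zero (suc c) i = trans (cong (_+_ 0ℚ) (sumFrom-zero c (suc i))) refl

sumFrom-last : ∀ f c i → sumFrom f (suc c) i ≡ sumFrom f c i + f (i ℕ.+ c)
sumFrom-last f zero    i = trans (ℚₚ.+-comm (f i) 0ℚ) (cong (λ r → 0ℚ + f r) (sym (ℕₚ.+-identityʳ i)))
sumFrom-last f (suc c) i = begin
  f i + sumFrom f (suc c) (suc i)
    ≡⟨ cong (_+_ (f i)) (sumFrom-last f c (suc i)) ⟩
  f i + (sumFrom f c (suc i) + f (suc i ℕ.+ c))
    ≡⟨ ℚₚ.+-assoc (f i) _ _ ⟨
  f i + sumFrom f c (suc i) + f (suc i ℕ.+ c)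
    ≡⟨ cong (λ r → f i + sumFrom f c (suc i) + f r) (sym (ℕₚ.+-suc i c)) ⟩
  f i + sumFrom f c (suc i) + f (i ℕ.+ suc c) ∎

⊛-sumFrom : ∀ F G m → (F ⊛ G) m ≡ sumFrom (λ i → F i * G (m ∸ i)) (suc m) 0
⊛-sumFrom F G m = Σ-sumFrom (λ i → F i * G (m ∸ i)) 0 m

⊛-congˡ : ∀ {F F′} G → F ≗ₛ F′ → F ⊛ G ≗ₛ F′ ⊛ G
⊛-congˡ G eq m = Σ-cong 0 m (λ i _ _ → cong (_* G (m ∸ i)) (eq i))

⊛-congʳ : ∀ F {G G′} → G ≗ₛ G′ → F ⊛ G ≗ₛ F ⊛ G′
⊛-congʳ F eq m = Σ-cong 0 m (λ i _ _ → cong (F i *_) (eq (m ∸ i)))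

⊛-zeroˡ : ∀ G m → ((λ _ → 0ℚ) ⊛ G) m ≡ 0ℚ
⊛-zeroˡ G m = begin
  ((λ _ → 0ℚ) ⊛ G) m                         ≡⟨ ⊛-sumFrom (λ _ → 0ℚ) G m ⟩
  sumFrom (λ i → 0ℚ * G (m ∸ i)) (suc m) 0   ≡⟨ sumFrom-cong′ (suc m) 0 (λ i → ℚₚ.*-zeroˡ (G (m ∸ i))) ⟩
  sumFrom (λ _ → 0ℚ) (suc m) 0               ≡⟨ sumFrom-zero (suc m) 0 ⟩
  0ℚ                                         ∎

⊛-zeroʳ : ∀ F m → (F ⊛ (λ _ → 0ℚ)) m ≡ 0ℚ
⊛-zeroʳ F m = begin
  (F ⊛ (λ _ → 0ℚ)) m                  ≡⟨ ⊛-sumFrom F (λ _ → 0ℚ) m ⟩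
  sumFrom (λ i → F i * 0ℚ) (suc m) 0  ≡⟨ sumFrom-cong′ (suc m) 0 (λ i → ℚₚ.*-zeroʳ (F i)) ⟩
  sumFrom (λ _ → 0ℚ) (suc m) 0        ≡⟨ sumFrom-zero (suc m) 0 ⟩
  0ℚ                                  ∎

⊛-linearˡ : ∀ a F F′ G m →
            ((λ r → a * F r + F′ r) ⊛ G) m ≡ a * (F ⊛ G) m + (F′ ⊛ G) m
⊛-linearˡ a F F′ G m = begin
  ((λ r → a * F r + F′ r) ⊛ G) m
    ≡⟨ ⊛-sumFrom (λ r → a * F r + F′ r) G m ⟩
  sumFrom (λ r → (a * F r + F′ r) * G (m ∸ r)) (suc m) 0
    ≡⟨ sumFrom-cong′ (suc m) 0 (λ r →
         solve 4 (λ a x y z → (a :* x :+ y) :* z := a :* (x :* z) :+ y :* z) refl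
           a (F r) (F′ r) (G (m ∸ r))) ⟩
  sumFrom (λ r → a * (F r * G (m ∸ r)) + F′ r * G (m ∸ r)) (suc m) 0
    ≡⟨ sumFrom-+ (λ r → a * (F r * G (m ∸ r))) (λ r → F′ r * G (m ∸ r)) (suc m) 0 ⟩
  sumFrom (λ r → a * (F r * G (m ∸ r))) (suc m) 0 + sumFrom (λ r → F′ r * G (m ∸ r)) (suc m) 0
    ≡⟨ cong (_+ sumFrom (λ r → F′ r * G (m ∸ r)) (suc m) 0) (sumFrom-scale a _ (suc m) 0) ⟩
  a * sumFrom (λ r → F r * G (m ∸ r)) (suc m) 0 + sumFrom (λ r → F′ r * G (m ∸ r)) (suc m) 0
    ≡⟨ cong₂ (λ x y → a * x + y) (⊛-sumFrom F G m) (⊛-sumFrom F′ G m) ⟨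
  a * (F ⊛ G) m + (F′ ⊛ G) m ∎

⊛-linearʳ : ∀ b F G G′ m →
            (F ⊛ (λ s → b * G s + G′ s)) m ≡ b * (F ⊛ G) m + (F ⊛ G′) m
⊛-linearʳ b F G G′ m = begin
  (F ⊛ (λ s → b * G s + G′ s)) m
    ≡⟨ ⊛-sumFrom F (λ s → b * G s + G′ s) m ⟩
  sumFrom (λ r → F r * (b * G (m ∸ r) + G′ (m ∸ r))) (suc m) 0
    ≡⟨ sumFrom-cong′ (suc m) 0 (λ r →
         solve 4 (λ b x y z → x :* (b :* y :+ z) := b :* (x :* y) :+ x :* z) refl
           b (F r) (G (m ∸ r)) (G′ (m ∸ r))) ⟩
  sumFrom (λ r → b * (F r * G (m ∸ r)) + F r * G′ (m ∸ r)) (suc m) 0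
    ≡⟨ sumFrom-+ (λ r → b * (F r * G (m ∸ r))) (λ r → F r * G′ (m ∸ r)) (suc m) 0 ⟩
  sumFrom (λ r → b * (F r * G (m ∸ r))) (suc m) 0 + sumFrom (λ r → F r * G′ (m ∸ r)) (suc m) 0
    ≡⟨ cong (_+ sumFrom (λ r → F r * G′ (m ∸ r)) (suc m) 0) (sumFrom-scale b _ (suc m) 0) ⟩
  b * sumFrom (λ r → F r * G (m ∸ r)) (suc m) 0 + sumFrom (λ r → F r * G′ (m ∸ r)) (suc m) 0
    ≡⟨ cong₂ (λ x y → b * x + y) (⊛-sumFrom F G m) (⊛-sumFrom F G′ m) ⟨
  b * (F ⊛ G) m + (F ⊛ G′) m ∎

⊛-drop-leftmost : ∀ F G → F 0 ≡ 0ℚ → ∀ m → (F ⊛ G) (suc m) ≡ ((λ r → F (suc r)) ⊛ G) m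
⊛-drop-leftmost F G F0 m = begin
  (F ⊛ G) (suc m)
    ≡⟨ ⊛-sumFrom F G (suc m) ⟩
  F 0 * G (suc m) + sumFrom (λ r → F r * G (suc m ∸ r)) (suc m) 1
    ≡⟨ cong (λ z → z * G (suc m) + sumFrom (λ r → F r * G (suc m ∸ r)) (suc m) 1) F0 ⟩
  0ℚ * G (suc m) + sumFrom (λ r → F r * G (suc m ∸ r)) (suc m) 1
    ≡⟨ cong (_+ sumFrom (λ r → F r * G (suc m ∸ r)) (suc m) 1) (ℚₚ.*-zeroˡ (G (suc m))) ⟩
  0ℚ + sumFrom (λ r → F r * G (suc m ∸ r)) (suc m) 1
    ≡⟨ ℚₚ.+-identityˡ _ ⟩
  sumFrom (λ r → F r * G (suc m ∸ r)) (suc m) 1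
    ≡⟨ sumFrom-shift (λ r → F r * G (suc m ∸ r)) (suc m) 0 ⟩
  sumFrom (λ r → F (suc r) * G (m ∸ r)) (suc m) 0
    ≡⟨ ⊛-sumFrom (λ r → F (suc r)) G m ⟨
  ((λ r → F (suc r)) ⊛ G) m ∎

⊛-drop-rightmost : ∀ F G → G 0 ≡ 0ℚ → ∀ m → (F ⊛ G) (suc m) ≡ (F ⊛ (λ s → G (suc s))) m
⊛-drop-rightmost F G G0 m = begin
  (F ⊛ G) (suc m)
    ≡⟨ ⊛-sumFrom F G (suc m) ⟩
  sumFrom X (suc (suc m)) 0
    ≡⟨ sumFrom-last X (suc m) 0 ⟩
  sumFrom X (suc m) 0 + F (suc m) * G (m ∸ m)
    ≡⟨ cong (λ s → sumFrom X (suc m) 0 + F (suc m) * G s) (ℕₚ.n∸n≡0 m) ⟩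
  sumFrom X (suc m) 0 + F (suc m) * G 0
    ≡⟨ cong (λ z → sumFrom X (suc m) 0 + F (suc m) * z) G0 ⟩
  sumFrom X (suc m) 0 + F (suc m) * 0ℚ
    ≡⟨ cong (_+_ (sumFrom X (suc m) 0)) (ℚₚ.*-zeroʳ (F (suc m))) ⟩
  sumFrom X (suc m) 0 + 0ℚ
    ≡⟨ ℚₚ.+-identityʳ _ ⟩
  sumFrom X (suc m) 0
    ≡⟨ sumFrom-cong (suc m) 0 (λ r _ r< → cong (λ s → F r * G s)
         (ℕₚ.+-∸-assoc 1 (ℕₚ.≤-pred (subst (r <_) (ℕₚ.+-identityʳ (suc m)) r<)))) ⟩
  sumFrom (λ r → F r * G (suc (m ∸ r))) (suc m) 0
    ≡⟨ ⊛-sumFrom F (λ s → G (suc s)) m ⟨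
  (F ⊛ (λ s → G (suc s))) m ∎
  where
  X : ℕ → ℚ
  X r = F r * G (suc m ∸ r)

⊛-shifted : ∀ p q k F G → (∀ r → r < p → F r ≡ 0ℚ) → (∀ s → s < q → G s ≡ 0ℚ) →
  sumFrom (λ j → F (p ℕ.+ j) * G (q ℕ.+ (k ∸ j))) (suc k) 0 ≡ (F ⊛ G) (p ℕ.+ q ℕ.+ k)
⊛-shifted zero zero k F G _ _ = sym (⊛-sumFrom F G k)
⊛-shifted zero (suc q) k F G F-low G-low =
  trans (⊛-shifted 0 q k F (λ s → G (suc s)) F-low (λ s s<q → G-low (suc s) (s≤s s<q)))
        (sym (⊛-drop-rightmost F G (G-low 0 (s≤s z≤n)) (q ℕ.+ k)))
⊛-shifted (suc p) q k F G F-low G-low =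
  trans (⊛-shifted p q k (λ r → F (suc r)) G (λ r r<p → F-low (suc r) (s≤s r<p)) G-low)
        (sym (⊛-drop-leftmost F G (F-low 0 (s≤s z≤n)) (p ℕ.+ q ℕ.+ k)))

-- ℕ→ℚ n in normal form, so that ℚ's inverse law applies to it.
ℕ→ℚ-normal : ∀ n → ℕ→ℚ n ≡ mkℚ (+ n) 0 (Coprimality.sym (Coprimality.1-coprimeTo n))
ℕ→ℚ-normal n = ℚₚ.normalize-coprime (Coprimality.sym (Coprimality.1-coprimeTo n))

-- 1/n in normal form (junk value 0 at n = 0).
inv : ℕ → ℚ
inv zero    = 0ℚ
inv (suc d) = mkℚ (+ 1) d (Coprimality.1-coprimeTo (suc d))

1/≡inv : ∀ d → (+ 1) / suc d ≡ inv (suc d)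
1/≡inv d = ℚₚ.normalize-coprime (Coprimality.1-coprimeTo (suc d))

ℕ→ℚ*inv : ∀ d → ℕ→ℚ (suc d) * inv (suc d) ≡ 1ℚ
ℕ→ℚ*inv d = trans (cong (_* inv (suc d)) (ℕ→ℚ-normal (suc d)))
                  (ℚₚ.*-inverseʳ (mkℚ (+ suc d) 0 (Coprimality.sym (Coprimality.1-coprimeTo (suc d)))))

cancel-suc : ∀ m x → ℕ→ℚ (suc m) * x * inv (suc m) ≡ x
cancel-suc m x = begin
  ℕ→ℚ (suc m) * x * inv (suc m)   ≡⟨ solve 3 (λ n x i → n :* x :* i := x :* (n :* i)) refl
                                        (ℕ→ℚ (suc m)) x (inv (suc m)) ⟩
  x * (ℕ→ℚ (suc m) * inv (suc m)) ≡⟨ cong (x *_) (ℕ→ℚ*inv m) ⟩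
  x * 1ℚ                          ≡⟨ ℚₚ.*-identityʳ x ⟩
  x                               ∎

ℕ→ℚ-suc : ∀ n → ℕ→ℚ (suc n) ≡ 1ℚ + ℕ→ℚ n
ℕ→ℚ-suc n = trans (ℚₚ./-cong {+ suc n} {1} numerators refl) (cong (_+_ 1ℚ) (sym (ℕ→ℚ-normal n)))
  where
  numerators : + suc n ≡ (+ 1) ℤ.* (+ 1) ℤ.+ (+ n) ℤ.* (+ 1)
  numerators = cong (ℤ._+_ (+ 1)) (sym (ℤₚ.*-identityʳ (+ n)))

ℕ→ℚ-+ : ∀ m n → ℕ→ℚ (m ℕ.+ n) ≡ ℕ→ℚ m + ℕ→ℚ n
ℕ→ℚ-+ zero    n = sym (ℚₚ.+-identityˡ (ℕ→ℚ n))
ℕ→ℚ-+ (suc m) n = begin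
  ℕ→ℚ (suc (m ℕ.+ n))       ≡⟨ ℕ→ℚ-suc (m ℕ.+ n) ⟩
  1ℚ + ℕ→ℚ (m ℕ.+ n)        ≡⟨ cong (_+_ 1ℚ) (ℕ→ℚ-+ m n) ⟩
  1ℚ + (ℕ→ℚ m + ℕ→ℚ n)      ≡⟨ ℚₚ.+-assoc 1ℚ (ℕ→ℚ m) (ℕ→ℚ n) ⟨
  1ℚ + ℕ→ℚ m + ℕ→ℚ n        ≡⟨ cong (_+ ℕ→ℚ n) (ℕ→ℚ-suc m) ⟨
  ℕ→ℚ (suc m) + ℕ→ℚ n       ∎

ℕ→ℚ-* : ∀ m n → ℕ→ℚ (m ℕ.* n) ≡ ℕ→ℚ m * ℕ→ℚ n
ℕ→ℚ-* zero    n = sym (ℚₚ.*-zeroˡ (ℕ→ℚ n))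
ℕ→ℚ-* (suc m) n = begin
  ℕ→ℚ (n ℕ.+ m ℕ.* n)       ≡⟨ ℕ→ℚ-+ n (m ℕ.* n) ⟩
  ℕ→ℚ n + ℕ→ℚ (m ℕ.* n)     ≡⟨ cong (_+_ (ℕ→ℚ n)) (ℕ→ℚ-* m n) ⟩
  ℕ→ℚ n + ℕ→ℚ m * ℕ→ℚ n     ≡⟨ solve 2 (λ a b → a :+ b :* a := (con 1ℚ :+ b) :* a) refl (ℕ→ℚ n) (ℕ→ℚ m) ⟩
  (1ℚ + ℕ→ℚ m) * ℕ→ℚ n      ≡⟨ cong (_* ℕ→ℚ n) (ℕ→ℚ-suc m) ⟨
  ℕ→ℚ (suc m) * ℕ→ℚ n       ∎

two : ℚ
two = ℕ→ℚ 2

inv-double : ∀ m → inv (2 ℕ.* suc m) * two ≡ inv (suc m)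
inv-double m = begin
  i₂ * two                                   ≡⟨ cancel-suc m (i₂ * two) ⟨
  ℕ→ℚ (suc m) * (i₂ * two) * i₁              ≡⟨ cong (_* i₁) (solve 3 (λ n a t → n :* (a :* t) := t :* n :* a) refl
                                                  (ℕ→ℚ (suc m)) i₂ two) ⟩
  two * ℕ→ℚ (suc m) * i₂ * i₁                ≡⟨ cong (λ z → z * i₂ * i₁) (ℕ→ℚ-* 2 (suc m)) ⟨
  ℕ→ℚ (2 ℕ.* suc m) * i₂ * i₁                ≡⟨ cong (_* i₁) (ℕ→ℚ*inv (m ℕ.+ suc (m ℕ.+ 0))) ⟩
  1ℚ * i₁                                    ≡⟨ ℚₚ.*-identityˡ i₁ ⟩
  i₁                                         ∎
  where
  i₁ i₂ : ℚ
  i₁ = inv (suc m)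
  i₂ = inv (2 ℕ.* suc m)

E : ℚ → Series
E e zero    = 1ℚ
E e (suc m) = e * E e m * inv (suc m)

E-suc : ∀ e m → ℕ→ℚ (suc m) * E e (suc m) ≡ e * E e m
E-suc e m = trans (sym (ℚₚ.*-assoc (ℕ→ℚ (suc m)) (e * E e m) (inv (suc m)))) (cancel-suc m (e * E e m))

-- The two halves of the binomial step: splitting the weight N+1 = r + (N+1-r)
-- in Σ_r E_a(r) E_b(N+1-r), each half is a multiple of (E_a ⊛ E_b)(N).
E-⊛-left : ∀ a b N →
  sumFrom (λ r → ℕ→ℚ r * (E a r * E b (suc N ∸ r))) (suc (suc N)) 0 ≡ a * (E a ⊛ E b) N
E-⊛-left a b N = begin
  ℕ→ℚ 0 * X 0 + sumFrom (λ r → ℕ→ℚ r * X r) (suc N) 1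
    ≡⟨ cong (_+ sumFrom (λ r → ℕ→ℚ r * X r) (suc N) 1) (ℚₚ.*-zeroˡ (X 0)) ⟩
  0ℚ + sumFrom (λ r → ℕ→ℚ r * X r) (suc N) 1
    ≡⟨ ℚₚ.+-identityˡ _ ⟩
  sumFrom (λ r → ℕ→ℚ r * X r) (suc N) 1
    ≡⟨ sumFrom-shift (λ r → ℕ→ℚ r * X r) (suc N) 0 ⟩
  sumFrom (λ r → ℕ→ℚ (suc r) * (E a (suc r) * E b (N ∸ r))) (suc N) 0
    ≡⟨ sumFrom-cong′ (suc N) 0 (λ r → begin
         ℕ→ℚ (suc r) * (E a (suc r) * E b (N ∸ r))
           ≡⟨ ℚₚ.*-assoc (ℕ→ℚ (suc r)) (E a (suc r)) (E b (N ∸ r)) ⟨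
         ℕ→ℚ (suc r) * E a (suc r) * E b (N ∸ r)
           ≡⟨ cong (_* E b (N ∸ r)) (E-suc a r) ⟩
         a * E a r * E b (N ∸ r)
           ≡⟨ ℚₚ.*-assoc a (E a r) (E b (N ∸ r)) ⟩
         a * (E a r * E b (N ∸ r)) ∎) ⟩
  sumFrom (λ r → a * (E a r * E b (N ∸ r))) (suc N) 0
    ≡⟨ sumFrom-scale a (λ r → E a r * E b (N ∸ r)) (suc N) 0 ⟩
  a * sumFrom (λ r → E a r * E b (N ∸ r)) (suc N) 0
    ≡⟨ cong (a *_) (⊛-sumFrom (E a) (E b) N) ⟨
  a * (E a ⊛ E b) N ∎
  where
  X : ℕ → ℚ
  X r = E a r * E b (suc N ∸ r)

E-⊛-right : ∀ a b N →
  sumFrom (λ r → ℕ→ℚ (suc N ∸ r) * (E a r * E b (suc N ∸ r))) (suc (suc N)) 0 ≡ b * (E a ⊛ E b) N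
E-⊛-right a b N = begin
  sumFrom Y (suc (suc N)) 0
    ≡⟨ sumFrom-last Y (suc N) 0 ⟩
  sumFrom Y (suc N) 0 + ℕ→ℚ (N ∸ N) * X (suc N)
    ≡⟨ cong (λ d → sumFrom Y (suc N) 0 + ℕ→ℚ d * X (suc N)) (ℕₚ.n∸n≡0 N) ⟩
  sumFrom Y (suc N) 0 + ℕ→ℚ 0 * X (suc N)
    ≡⟨ cong (_+_ (sumFrom Y (suc N) 0)) (ℚₚ.*-zeroˡ (X (suc N))) ⟩
  sumFrom Y (suc N) 0 + 0ℚ
    ≡⟨ ℚₚ.+-identityʳ _ ⟩
  sumFrom Y (suc N) 0
    ≡⟨ sumFrom-cong (suc N) 0 (λ r _ r< →
         weighted r (ℕₚ.≤-pred (subst (r <_) (ℕₚ.+-identityʳ (suc N)) r<))) ⟩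
  sumFrom (λ r → b * (E a r * E b (N ∸ r))) (suc N) 0
    ≡⟨ sumFrom-scale b (λ r → E a r * E b (N ∸ r)) (suc N) 0 ⟩
  b * sumFrom (λ r → E a r * E b (N ∸ r)) (suc N) 0
    ≡⟨ cong (b *_) (⊛-sumFrom (E a) (E b) N) ⟨
  b * (E a ⊛ E b) N ∎
  where
  X Y : ℕ → ℚ
  X r = E a r * E b (suc N ∸ r)
  Y r = ℕ→ℚ (suc N ∸ r) * X r
  weighted : ∀ r → r ≤ N → Y r ≡ b * (E a r * E b (N ∸ r))
  weighted r r≤N rewrite ℕₚ.+-∸-assoc 1 r≤N = begin
    ℕ→ℚ (suc (N ∸ r)) * (E a r * E b (suc (N ∸ r)))
      ≡⟨ solve 3 (λ n x y → n :* (x :* y) := x :* (n :* y)) refl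
           (ℕ→ℚ (suc (N ∸ r))) (E a r) (E b (suc (N ∸ r))) ⟩
    E a r * (ℕ→ℚ (suc (N ∸ r)) * E b (suc (N ∸ r)))
      ≡⟨ cong (E a r *_) (E-suc b (N ∸ r)) ⟩
    E a r * (b * E b (N ∸ r))
      ≡⟨ solve 3 (λ x b y → x :* (b :* y) := b :* (x :* y)) refl (E a r) b (E b (N ∸ r)) ⟩
    b * (E a r * E b (N ∸ r)) ∎

E-⊛-step : ∀ a b N → ℕ→ℚ (suc N) * (E a ⊛ E b) (suc N) ≡ (a + b) * (E a ⊛ E b) N
E-⊛-step a b N = begin
  ℕ→ℚ (suc N) * (E a ⊛ E b) (suc N)
    ≡⟨ cong (ℕ→ℚ (suc N) *_) (⊛-sumFrom (E a) (E b) (suc N)) ⟩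
  ℕ→ℚ (suc N) * sumFrom X (suc (suc N)) 0
    ≡⟨ sumFrom-scale (ℕ→ℚ (suc N)) X (suc (suc N)) 0 ⟨
  sumFrom (λ r → ℕ→ℚ (suc N) * X r) (suc (suc N)) 0
    ≡⟨ sumFrom-cong (suc (suc N)) 0 split ⟩
  sumFrom (λ r → ℕ→ℚ r * X r + ℕ→ℚ (suc N ∸ r) * X r) (suc (suc N)) 0
    ≡⟨ sumFrom-+ (λ r → ℕ→ℚ r * X r) (λ r → ℕ→ℚ (suc N ∸ r) * X r) (suc (suc N)) 0 ⟩
  sumFrom (λ r → ℕ→ℚ r * X r) (suc (suc N)) 0 + sumFrom (λ r → ℕ→ℚ (suc N ∸ r) * X r) (suc (suc N)) 0
    ≡⟨ cong₂ _+_ (E-⊛-left a b N) (E-⊛-right a b N) ⟩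
  a * (E a ⊛ E b) N + b * (E a ⊛ E b) N
    ≡⟨ ℚₚ.*-distribʳ-+ ((E a ⊛ E b) N) a b ⟨
  (a + b) * (E a ⊛ E b) N ∎
  where
  X : ℕ → ℚ
  X r = E a r * E b (suc N ∸ r)
  split : ∀ r → 0 ≤ r → r < suc (suc N) ℕ.+ 0 →
          ℕ→ℚ (suc N) * X r ≡ ℕ→ℚ r * X r + ℕ→ℚ (suc N ∸ r) * X r
  split r _ r< = begin
    ℕ→ℚ (suc N) * X r                    ≡⟨ cong (λ n → ℕ→ℚ n * X r) (ℕₚ.m+[n∸m]≡n r≤) ⟨
    ℕ→ℚ (r ℕ.+ (suc N ∸ r)) * X r        ≡⟨ cong (_* X r) (ℕ→ℚ-+ r (suc N ∸ r)) ⟩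
    (ℕ→ℚ r + ℕ→ℚ (suc N ∸ r)) * X r      ≡⟨ ℚₚ.*-distribʳ-+ (X r) (ℕ→ℚ r) (ℕ→ℚ (suc N ∸ r)) ⟩
    ℕ→ℚ r * X r + ℕ→ℚ (suc N ∸ r) * X r  ∎
    where
    r≤ : r ≤ suc N
    r≤ = ℕₚ.≤-pred (subst (r <_) (ℕₚ.+-identityʳ (suc (suc N))) r<)

E-⊛ : ∀ a b m → (E a ⊛ E b) m ≡ E (a + b) m
E-⊛ a b zero    = refl
E-⊛ a b (suc N) = begin
  (E a ⊛ E b) (suc N)                          ≡⟨ cancel-suc N _ ⟨
  ℕ→ℚ (suc N) * (E a ⊛ E b) (suc N) * inv (suc N) ≡⟨ cong (_* inv (suc N)) (E-⊛-step a b N) ⟩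
  (a + b) * (E a ⊛ E b) N * inv (suc N)        ≡⟨ cong (λ z → (a + b) * z * inv (suc N)) (E-⊛ a b N) ⟩
  E (a + b) (suc N)                            ∎

-- (b , e) stands for b·X_e.
-- Formal finite combinations Σ b·X_e over a family of sequences X_e.
Term : Set
Term = ℚ × ℚ

Combo : Set
Combo = List Term

Basis : Set
Basis = ℚ → Series

eval : Basis → Combo → Series
eval X []            m = 0ℚ
eval X ((b , e) ∷ A) m = b * X e m + eval X A m

eval-++ : ∀ X A B m → eval X (A ++ B) m ≡ eval X A m + eval X B m
eval-++ X []            B m = sym (ℚₚ.+-identityˡ _)
eval-++ X ((b , e) ∷ A) B m =
  trans (cong (_+_ (b * X e m)) (eval-++ X A B m)) (sym (ℚₚ.+-assoc (b * X e m) _ _))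

scale : ℚ → Combo → Combo
scale c []            = []
scale c ((b , e) ∷ A) = (c * b , e) ∷ scale c A

eval-scale : ∀ X c A m → eval X (scale c A) m ≡ c * eval X A m
eval-scale X c []            m = sym (ℚₚ.*-zeroʳ c)
eval-scale X c ((b , e) ∷ A) m =
  trans (cong₂ _+_ (ℚₚ.*-assoc c b (X e m)) (eval-scale X c A m))
        (sym (ℚₚ.*-distribˡ-+ c (b * X e m) (eval X A m)))

eval-scale-++ : ∀ X c A B m → eval X (scale c A ++ B) m ≡ c * eval X A m + eval X B m
eval-scale-++ X c A B m = trans (eval-++ X (scale c A) B m) (cong (_+ eval X B m) (eval-scale X c A m))

insert : Term → Combo → Combo
insert t [] = t ∷ []
insert (b , e) ((b′ , e′) ∷ A) with e ℚ.≟ e′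
... | yes _ = (b + b′ , e′) ∷ A
... | no _ with e ℚ.≤? e′
...   | yes _ = (b , e) ∷ (b′ , e′) ∷ A
...   | no _  = (b′ , e′) ∷ insert (b , e) A

sort : Combo → Combo
sort []      = []
sort (t ∷ A) = insert t (sort A)

dropZeros : Combo → Combo
dropZeros [] = []
dropZeros ((b , e) ∷ A) with b ℚ.≟ 0ℚ
... | yes _ = dropZeros A
... | no _  = (b , e) ∷ dropZeros A

normalize : Combo → Combo
normalize A = dropZeros (sort A)

eval-insert : ∀ X t A m → eval X (insert t A) m ≡ eval X (t ∷ A) m
eval-insert X t [] m = refl
eval-insert X (b , e) ((b′ , e′) ∷ A) m with e ℚ.≟ e′
... | yes refl = trans (cong (_+ eval X A m) (ℚₚ.*-distribʳ-+ (X e m) b b′))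
                       (ℚₚ.+-assoc (b * X e m) (b′ * X e m) _)
... | no _ with e ℚ.≤? e′
...   | yes _ = refl
...   | no _  = trans (cong (_+_ (b′ * X e′ m)) (eval-insert X (b , e) A m))
                      (solve 3 (λ x y z → x :+ (y :+ z) := y :+ (x :+ z)) refl
                         (b′ * X e′ m) (b * X e m) (eval X A m))

eval-sort : ∀ X A m → eval X (sort A) m ≡ eval X A m
eval-sort X []            m = refl
eval-sort X ((b , e) ∷ A) m =
  trans (eval-insert X (b , e) (sort A) m) (cong (_+_ (b * X e m)) (eval-sort X A m))

eval-dropZeros : ∀ X A m → eval X (dropZeros A) m ≡ eval X A m
eval-dropZeros X [] m = refl
eval-dropZeros X ((b , e) ∷ A) m with b ℚ.≟ 0ℚ
... | yes refl = trans (eval-dropZeros X A m)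
                       (sym (trans (cong (_+ eval X A m) (ℚₚ.*-zeroˡ (X e m))) (ℚₚ.+-identityˡ _)))
... | no _     = cong (_+_ (b * X e m)) (eval-dropZeros X A m)

-- Combinations with the same normal form denote the same sequence, whatever
-- the basis; this is how every identity between combinations is decided.
eval-normalize : ∀ X A B → normalize A ≡ normalize B → ∀ m → eval X A m ≡ eval X B m
eval-normalize X A B same m = begin
  eval X A m                    ≡⟨ eval-sort X A m ⟨
  eval X (sort A) m             ≡⟨ eval-dropZeros X (sort A) m ⟨
  eval X (normalize A) m        ≡⟨ cong (λ C → eval X C m) same ⟩
  eval X (normalize B) m        ≡⟨ eval-dropZeros X (sort B) m ⟩
  eval X (sort B) m             ≡⟨ eval-sort X B m ⟩
  eval X B m                    ∎

-- Derivative of Σ b·exp(e t): multiply each coefficient by its base.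
derive : Combo → Combo
derive []            = []
derive ((b , e) ∷ A) = (b * e , e) ∷ derive A

eval-E-suc : ∀ A m → eval E A (suc m) ≡ eval E (derive A) m * inv (suc m)
eval-E-suc []            m = sym (ℚₚ.*-zeroˡ (inv (suc m)))
eval-E-suc ((b , e) ∷ A) m =
  trans (cong₂ _+_ (solve 4 (λ b e x i → b :* (e :* x :* i) := b :* e :* x :* i) refl
                      b e (E e m) (inv (suc m)))
                   (eval-E-suc A m))
        (sym (ℚₚ.*-distribʳ-+ (inv (suc m)) (b * e * E e m) (eval E (derive A) m)))

-- The Cauchy product of E-combinations, termwise by the binomial theorem:
-- (a·E_e) ⋆ (b·E_f) = ab·E_{e+f}.
times : Term → Combo → Combo
times t       []            = []
times (a , e) ((b , f) ∷ C) = (a * b , e + f) ∷ times (a , e) C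

infixl 7 _⋆_
_⋆_ : Combo → Combo → Combo
[]      ⋆ B = []
(t ∷ A) ⋆ B = times t B ++ (A ⋆ B)

eval-⋆ : ∀ A B m → (eval E A ⊛ eval E B) m ≡ eval E (A ⋆ B) m
eval-⋆ []            B m = ⊛-zeroˡ (eval E B) m
eval-⋆ ((a , e) ∷ A) B m = begin
  ((λ r → a * E e r + eval E A r) ⊛ eval E B) m
    ≡⟨ ⊛-linearˡ a (E e) (eval E A) (eval E B) m ⟩
  a * (E e ⊛ eval E B) m + (eval E A ⊛ eval E B) m
    ≡⟨ cong₂ _+_ (term B) (eval-⋆ A B m) ⟩
  eval E (times (a , e) B) m + eval E (A ⋆ B) m
    ≡⟨ eval-++ E (times (a , e) B) (A ⋆ B) m ⟨
  eval E (times (a , e) B ++ (A ⋆ B)) m ∎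
  where
  term : ∀ C → a * (E e ⊛ eval E C) m ≡ eval E (times (a , e) C) m
  term []            = trans (cong (a *_) (⊛-zeroʳ (E e) m)) (ℚₚ.*-zeroʳ a)
  term ((b , f) ∷ C) = begin
    a * (E e ⊛ (λ s → b * E f s + eval E C s)) m
      ≡⟨ cong (a *_) (⊛-linearʳ b (E e) (E f) (eval E C) m) ⟩
    a * (b * (E e ⊛ E f) m + (E e ⊛ eval E C) m)
      ≡⟨ cong (λ z → a * (b * z + (E e ⊛ eval E C) m)) (E-⊛ e f m) ⟩
    a * (b * E (e + f) m + (E e ⊛ eval E C) m)
      ≡⟨ solve 4 (λ a b x y → a :* (b :* x :+ y) := a :* b :* x :+ a :* y) refl
           a b (E (e + f) m) ((E e ⊛ eval E C) m) ⟩
    a * b * E (e + f) m + a * (E e ⊛ eval E C) m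
      ≡⟨ cong (_+_ (a * b * E (e + f) m)) (term C) ⟩
    a * b * E (e + f) m + eval E (times (a , e) C) m ∎

convolutionTerm : ℕ → ℕ → ℕ → ℕ → ℕ → ℚ
convolutionTerm f n k i j = ℕ→ℚ (i ℕ.* (n ∸ i)) * I-fuel f i j * I-fuel f (n ∸ i) (k ∸ j)

convolutionSum : ℕ → ℕ → ℕ → ℚ
convolutionSum f d k = Σ[ 1 , 1 ℕ.+ d ] (λ i → Σ[ 0 , k ] (convolutionTerm f (2 ℕ.+ d) k i))

mutual
  I-fuel-stable : ∀ f g n k → n ℕ.+ k < f → n ℕ.+ k < g → I-fuel f n k ≡ I-fuel g n k
  I-fuel-stable (suc f) (suc g) zero             k       _       _       = refl
  I-fuel-stable (suc f) (suc g) (suc zero)       zero    _       _       = refl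
  I-fuel-stable (suc f) (suc g) (suc zero)       (suc k) (s≤s p) (s≤s q) =
    cong (λ x → ((+ 1) / (2 ℕ.* suc k)) * (ℕ→ℚ 1 * x + 0ℚ)) (I-fuel-stable f g 1 k p q)
  I-fuel-stable (suc f) (suc g) (suc (suc n))    zero    (s≤s p) (s≤s q) =
    cong (λ s → ((+ 1) / (2 ℕ.* (suc (suc n) ℕ.+ 0 ∸ 1))) *
                  (ℕ→ℚ (suc (suc n) ℕ.* suc (suc n)) * 0ℚ + s))
         (convolutionSum-stable f g n 0 p q)
  I-fuel-stable (suc f) (suc g) (suc (suc n))    (suc k) (s≤s p) (s≤s q) =
    cong₂ (λ x s → ((+ 1) / (2 ℕ.* (suc (suc n) ℕ.+ suc k ∸ 1))) *
                     (ℕ→ℚ (suc (suc n) ℕ.* suc (suc n)) * x + s))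
          (I-fuel-stable f g (suc (suc n)) k (previous p) (previous q))
          (convolutionSum-stable f g n (suc k) p q)
    where
    previous : ∀ {h} → suc (suc n) ℕ.+ suc k ≤ h → suc (suc n) ℕ.+ k < h
    previous = ℕₚ.<-≤-trans (ℕₚ.+-monoʳ-< (suc (suc n)) (ℕₚ.n<1+n k))

  convolutionSum-stable : ∀ f g d k → 2 ℕ.+ d ℕ.+ k ≤ f → 2 ℕ.+ d ℕ.+ k ≤ g →
                          convolutionSum f d k ≡ convolutionSum g d k
  convolutionSum-stable f g d k p q =
    Σ-cong {λ i → Σ[ 0 , k ] (convolutionTerm f (2 ℕ.+ d) k i)}
           {λ i → Σ[ 0 , k ] (convolutionTerm g (2 ℕ.+ d) k i)} 1 d λ where
      (suc i) _ i≤d → Σ-cong {convolutionTerm f (2 ℕ.+ d) k (suc i)}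
                             {convolutionTerm g (2 ℕ.+ d) k (suc i)} 0 k λ j _ j≤k →
        cong₂ (λ x y → ℕ→ℚ (suc i ℕ.* (suc d ∸ i)) * x * y)
          (I-fuel-stable f g (suc i) j (bound (s≤s i≤d) j≤k p) (bound (s≤s i≤d) j≤k q))
          (I-fuel-stable f g (suc d ∸ i) (k ∸ j)
             (bound (s≤s (ℕₚ.m∸n≤m (suc d) i)) (ℕₚ.m∸n≤m k j) p)
             (bound (s≤s (ℕₚ.m∸n≤m (suc d) i)) (ℕₚ.m∸n≤m k j) q))
   where
   bound : ∀ {i j m l h} → i < m → j ≤ l → m ℕ.+ l ≤ h → i ℕ.+ j < h
   bound i<m j≤l ml≤h = ℕₚ.<-≤-trans (ℕₚ.+-mono-<-≤ i<m j≤l) ml≤h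

I-fuel≡I : ∀ f n k → n ℕ.+ k < f → I-fuel f n k ≡ I n k
I-fuel≡I f n k enough = I-fuel-stable f (suc (n ℕ.+ k)) n k enough ℕₚ.≤-refl

-- L is a closed form for I(p+1, ·): I(p+1,k) = L(p+k), and L vanishes
-- below p, matching I(p+1,k) = 0 for k < 0.
record ClosedForm (p : ℕ) (L : Combo) : Set where
  field
    values   : ∀ k → I (suc p) k ≡ eval E L (p ℕ.+ k)
    vanishes : ∀ r → r < p → eval E L r ≡ 0ℚ

closedForm-⊛ : ∀ {p q A B} → ClosedForm p A → ClosedForm q B →
  ∀ f k w → suc p ℕ.+ k < f → suc q ℕ.+ k < f →
  Σ[ 0 , k ] (λ j → w * I-fuel f (suc p) j * I-fuel f (suc q) (k ∸ j))
    ≡ w * eval E (A ⋆ B) (p ℕ.+ q ℕ.+ k)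
closedForm-⊛ {p} {q} {A} {B} cfA cfB f k w boundA boundB = begin
  Σ[ 0 , k ] (λ j → w * I-fuel f (suc p) j * I-fuel f (suc q) (k ∸ j))
    ≡⟨ Σ-cong {λ j → w * I-fuel f (suc p) j * I-fuel f (suc q) (k ∸ j)} 0 k (λ j _ j≤k → summand j j≤k) ⟩
  Σ[ 0 , k ] (λ j → w * (eval E A (p ℕ.+ j) * eval E B (q ℕ.+ (k ∸ j))))
    ≡⟨ Σ-sumFrom (λ j → w * (eval E A (p ℕ.+ j) * eval E B (q ℕ.+ (k ∸ j)))) 0 k ⟩
  sumFrom (λ j → w * (eval E A (p ℕ.+ j) * eval E B (q ℕ.+ (k ∸ j)))) (suc k) 0
    ≡⟨ sumFrom-scale w (λ j → eval E A (p ℕ.+ j) * eval E B (q ℕ.+ (k ∸ j))) (suc k) 0 ⟩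
  w * sumFrom (λ j → eval E A (p ℕ.+ j) * eval E B (q ℕ.+ (k ∸ j))) (suc k) 0
    ≡⟨ cong (w *_) (⊛-shifted p q k (eval E A) (eval E B) (ClosedForm.vanishes cfA) (ClosedForm.vanishes cfB)) ⟩
  w * (eval E A ⊛ eval E B) (p ℕ.+ q ℕ.+ k)
    ≡⟨ cong (w *_) (eval-⋆ A B (p ℕ.+ q ℕ.+ k)) ⟩
  w * eval E (A ⋆ B) (p ℕ.+ q ℕ.+ k) ∎
  where
  summand : ∀ j → j ≤ k → w * I-fuel f (suc p) j * I-fuel f (suc q) (k ∸ j)
                            ≡ w * (eval E A (p ℕ.+ j) * eval E B (q ℕ.+ (k ∸ j)))
  summand j j≤k = trans
    (cong₂ (λ x y → w * x * y)
      (trans (I-fuel≡I f (suc p) j (ℕₚ.≤-<-trans (ℕₚ.+-monoʳ-≤ (suc p) j≤k) boundA)) (ClosedForm.values cfA j))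
      (trans (I-fuel≡I f (suc q) (k ∸ j) (ℕₚ.≤-<-trans (ℕₚ.+-monoʳ-≤ (suc q) (ℕₚ.m∸n≤m k j)) boundB)) (ClosedForm.values cfB (k ∸ j))))
    (ℚₚ.*-assoc w _ _)

-- One step of the recursion: for E-combinations L(m+1) = L′(m)/(m+1), so
-- R(m)/(2(m+1)) = L(m+1) as soon as R and 2·L′ have the same normal form.
recursion-step : ∀ L R m → normalize (scale two (derive L)) ≡ normalize R →
                 ((+ 1) / (2 ℕ.* suc m)) * eval E R m ≡ eval E L (suc m)
recursion-step L R m same = begin
  ((+ 1) / (2 ℕ.* suc m)) * eval E R m
    ≡⟨ cong₂ _*_ (1/≡inv (m ℕ.+ suc (m ℕ.+ 0))) (sym (eval-normalize E (scale two (derive L)) R same m)) ⟩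
  inv (2 ℕ.* suc m) * eval E (scale two (derive L)) m
    ≡⟨ cong (inv (2 ℕ.* suc m) *_) (eval-scale E two (derive L) m) ⟩
  inv (2 ℕ.* suc m) * (two * eval E (derive L) m)
    ≡⟨ ℚₚ.*-assoc (inv (2 ℕ.* suc m)) two (eval E (derive L) m) ⟨
  inv (2 ℕ.* suc m) * two * eval E (derive L) m
    ≡⟨ cong (_* eval E (derive L) m) (inv-double m) ⟩
  inv (suc m) * eval E (derive L) m
    ≡⟨ ℚₚ.*-comm (inv (suc m)) (eval E (derive L) m) ⟩
  eval E (derive L) m * inv (suc m)
    ≡⟨ eval-E-suc L m ⟨
  eval E L (suc m) ∎

-- The closed-form induction for n = 1, where the recursion has no convolution part.
closedForm-one : ∀ L → eval E L 0 ≡ 1ℚ →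
  normalize (scale two (derive L)) ≡ normalize (scale (ℕ→ℚ 1) L ++ []) → ClosedForm 0 L
closedForm-one L initial recursion = record { values = values ; vanishes = λ _ () }
  where
  values : ∀ k → I 1 k ≡ eval E L k
  values zero    = sym initial
  values (suc k) = begin
    ((+ 1) / (2 ℕ.* suc k)) * (ℕ→ℚ 1 * I-fuel (suc (suc k)) 1 k + 0ℚ)
      ≡⟨ cong (λ x → ((+ 1) / (2 ℕ.* suc k)) * (ℕ→ℚ 1 * x + 0ℚ)) (trans (I-fuel≡I (suc (suc k)) 1 k ℕₚ.≤-refl) (values k)) ⟩
    ((+ 1) / (2 ℕ.* suc k)) * (ℕ→ℚ 1 * eval E L k + 0ℚ)
      ≡⟨ cong (((+ 1) / (2 ℕ.* suc k)) *_) (eval-scale-++ E (ℕ→ℚ 1) L [] k) ⟨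
    ((+ 1) / (2 ℕ.* suc k)) * eval E (scale (ℕ→ℚ 1) L ++ []) k
      ≡⟨ recursion-step L (scale (ℕ→ℚ 1) L ++ []) k recursion ⟩
    eval E L (suc k) ∎

sumCombo : (ℕ → Combo) → ℕ → ℕ → Combo
sumCombo C zero    i = []
sumCombo C (suc c) i = C i ++ sumCombo C c (suc i)

eval-sumCombo : ∀ X C c i m → eval X (sumCombo C c i) m ≡ sumFrom (λ r → eval X (C r) m) c i
eval-sumCombo X C zero    i m = refl
eval-sumCombo X C (suc c) i m =
  trans (eval-++ X (C i) (sumCombo C c (suc i)) m)
        (cong (_+_ (eval X (C i) m)) (eval-sumCombo X C c (suc i) m))

convolutionPart : ℕ → (ℕ → Combo) → Combo
convolutionPart n L = sumCombo (λ i → scale (ℕ→ℚ (i ℕ.* (n ∸ i))) (L i ⋆ L (n ∸ i))) (n ∸ 1) 1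

closedForm : ∀ d (L : ℕ → Combo) →
  (∀ p → p ≤ d → ClosedForm p (L (suc p))) →
  (∀ r → r < suc d → eval E (L (2 ℕ.+ d)) r ≡ 0ℚ) →
  normalize (scale two (derive (L (2 ℕ.+ d)))) ≡
    normalize (scale (ℕ→ℚ ((2 ℕ.+ d) ℕ.* (2 ℕ.+ d))) (L (2 ℕ.+ d)) ++ convolutionPart (2 ℕ.+ d) L) →
  ClosedForm (suc d) (L (2 ℕ.+ d))
closedForm d L smaller low recursion = record { values = values ; vanishes = low }
  where
  n : ℕ
  n = 2 ℕ.+ d
  R : Combo
  R = scale (ℕ→ℚ (n ℕ.* n)) (L n) ++ convolutionPart n L

  -- the summand i = 1+p, where n - i = 1 + (d - p)
  summand : ∀ k p → p ≤ d →
    Σ[ 0 , k ] (λ j → ℕ→ℚ (suc p ℕ.* (suc d ∸ p)) * I-fuel (n ℕ.+ k) (suc p) j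
                                                  * I-fuel (n ℕ.+ k) (suc d ∸ p) (k ∸ j))
    ≡ eval E (scale (ℕ→ℚ (suc p ℕ.* (suc d ∸ p))) (L (suc p) ⋆ L (suc d ∸ p))) (d ℕ.+ k)
  summand k p p≤d rewrite ℕₚ.+-∸-assoc 1 p≤d = begin
    Σ[ 0 , k ] (λ j → w * I-fuel (n ℕ.+ k) (suc p) j * I-fuel (n ℕ.+ k) (suc (d ∸ p)) (k ∸ j))
      ≡⟨ closedForm-⊛ (smaller p p≤d) (smaller (d ∸ p) (ℕₚ.m∸n≤m d p)) (n ℕ.+ k) k w
           (ℕₚ.+-monoˡ-< k (s≤s (s≤s p≤d))) (ℕₚ.+-monoˡ-< k (s≤s (s≤s (ℕₚ.m∸n≤m d p)))) ⟩
    w * eval E (L (suc p) ⋆ L (suc (d ∸ p))) (p ℕ.+ (d ∸ p) ℕ.+ k)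
      ≡⟨ cong (λ r → w * eval E (L (suc p) ⋆ L (suc (d ∸ p))) (r ℕ.+ k)) (ℕₚ.m+[n∸m]≡n p≤d) ⟩
    w * eval E (L (suc p) ⋆ L (suc (d ∸ p))) (d ℕ.+ k)
      ≡⟨ eval-scale E w (L (suc p) ⋆ L (suc (d ∸ p))) (d ℕ.+ k) ⟨
    eval E (scale w (L (suc p) ⋆ L (suc (d ∸ p)))) (d ℕ.+ k) ∎
    where
    w : ℚ
    w = ℕ→ℚ (suc p ℕ.* suc (d ∸ p))

  convolution-closed : ∀ k → convolutionSum (n ℕ.+ k) d k ≡ eval E (convolutionPart n L) (d ℕ.+ k)
  convolution-closed k = begin
    convolutionSum (n ℕ.+ k) d k
      ≡⟨ Σ-sumFrom S 1 d ⟩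
    sumFrom S (suc d) 1
      ≡⟨ sumFrom-cong {S} {λ i → eval E (C i) (d ℕ.+ k)} (suc d) 1 (λ where
           zero () _
           (suc p) _ i< → summand k p (ℕₚ.≤-pred (subst (suc p ≤_) (ℕₚ.+-comm d 1) (ℕₚ.≤-pred i<)))) ⟩
    sumFrom (λ i → eval E (C i) (d ℕ.+ k)) (suc d) 1
      ≡⟨ eval-sumCombo E C (suc d) 1 (d ℕ.+ k) ⟨
    eval E (convolutionPart n L) (d ℕ.+ k) ∎
    where
    S : ℕ → ℚ
    S i = Σ[ 0 , k ] (convolutionTerm (n ℕ.+ k) n k i)
    C : ℕ → Combo
    C i = scale (ℕ→ℚ (i ℕ.* (n ∸ i))) (L i ⋆ L (n ∸ i))

  -- the recursion, given the closed form x of I(n,k-1) (or 0 when k = 0)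
  step : ∀ k x → x ≡ eval E (L n) (d ℕ.+ k) →
    ((+ 1) / (2 ℕ.* (n ℕ.+ k ∸ 1))) * (ℕ→ℚ (n ℕ.* n) * x + convolutionSum (n ℕ.+ k) d k) ≡ eval E (L n) (suc d ℕ.+ k)
  step k x x≡ = begin
    c * (ℕ→ℚ (n ℕ.* n) * x + convolutionSum (n ℕ.+ k) d k)
      ≡⟨ cong₂ (λ y s → c * (ℕ→ℚ (n ℕ.* n) * y + s)) x≡ (convolution-closed k) ⟩
    c * (ℕ→ℚ (n ℕ.* n) * eval E (L n) (d ℕ.+ k) + eval E (convolutionPart n L) (d ℕ.+ k))
      ≡⟨ cong (c *_) (eval-scale-++ E (ℕ→ℚ (n ℕ.* n)) (L n) (convolutionPart n L) (d ℕ.+ k)) ⟨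
    c * eval E R (d ℕ.+ k)
      ≡⟨ recursion-step (L n) R (d ℕ.+ k) recursion ⟩
    eval E (L n) (suc d ℕ.+ k) ∎
    where
    c : ℚ
    c = (+ 1) / (2 ℕ.* suc (d ℕ.+ k))

  values : ∀ k → I n k ≡ eval E (L n) (suc d ℕ.+ k)
  values zero    = step 0 0ℚ (sym (low (d ℕ.+ 0) (s≤s (ℕₚ.≤-reflexive (ℕₚ.+-identityʳ d)))))
  values (suc k) = step (suc k) (I-fuel (n ℕ.+ suc k) n k)
    (trans (I-fuel≡I (n ℕ.+ suc k) n k (ℕₚ.+-monoʳ-< n (ℕₚ.n<1+n k)))
           (trans (values k) (cong (eval E (L n)) (sym (ℕₚ.+-suc d k)))))

Pow : Basis
Pow e k = e ^ℚ k

factorial-E : ∀ e m → ℕ→ℚ (m !) * E e m ≡ e ^ℚ m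
factorial-E e zero    = refl
factorial-E e (suc m) = begin
  ℕ→ℚ (suc m ℕ.* m !) * (e * E e m * inv (suc m))
    ≡⟨ cong (_* (e * E e m * inv (suc m))) (ℕ→ℚ-* (suc m) (m !)) ⟩
  ℕ→ℚ (suc m) * ℕ→ℚ (m !) * (e * E e m * inv (suc m))
    ≡⟨ solve 5 (λ s f e x i → s :* f :* (e :* x :* i) := e :* (f :* x) :* (s :* i)) refl
         (ℕ→ℚ (suc m)) (ℕ→ℚ (m !)) e (E e m) (inv (suc m)) ⟩
  e * (ℕ→ℚ (m !) * E e m) * (ℕ→ℚ (suc m) * inv (suc m))
    ≡⟨ cong₂ (λ x y → e * x * y) (factorial-E e m) (ℕ→ℚ*inv m) ⟩
  e * e ^ℚ m * 1ℚ
    ≡⟨ ℚₚ.*-identityʳ _ ⟩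
  e ^ℚ suc m ∎

eval-factorial : ∀ A m → ℕ→ℚ (m !) * eval E A m ≡ eval Pow A m
eval-factorial []            m = ℚₚ.*-zeroʳ (ℕ→ℚ (m !))
eval-factorial ((b , e) ∷ A) m =
  trans (ℚₚ.*-distribˡ-+ (ℕ→ℚ (m !)) (b * E e m) (eval E A m))
        (cong₂ _+_ (trans (solve 3 (λ f b x → f :* (b :* x) := b :* (f :* x)) refl (ℕ→ℚ (m !)) b (E e m))
                          (cong (b *_) (factorial-E e m)))
                   (eval-factorial A m))

ℕ→ℚ-2^ : ∀ k → ℕ→ℚ (2 ℕ.^ k) ≡ two ^ℚ k
ℕ→ℚ-2^ zero    = refl
ℕ→ℚ-2^ (suc k) = trans (ℕ→ℚ-* 2 (2 ℕ.^ k)) (cong (two *_) (ℕ→ℚ-2^ k))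

^-+ : ∀ e p k → e ^ℚ (p ℕ.+ k) ≡ e ^ℚ p * e ^ℚ k
^-+ e zero    k = sym (ℚₚ.*-identityˡ _)
^-+ e (suc p) k = trans (cong (e *_) (^-+ e p k)) (sym (ℚₚ.*-assoc e _ _))

^-* : ∀ a b k → a ^ℚ k * b ^ℚ k ≡ (a * b) ^ℚ k
^-* a b zero    = refl
^-* a b (suc k) =
  trans (solve 4 (λ a b x y → a :* x :* (b :* y) := a :* b :* (x :* y)) refl a b (a ^ℚ k) (b ^ℚ k))
        (cong ((a * b) *_) (^-* a b k))

1^ : ∀ k → 1ℚ ^ℚ k ≡ 1ℚ
1^ zero    = refl
1^ (suc k) = trans (ℚₚ.*-identityˡ _) (1^ k)

-- b·e^(p+k)·2^k = (b·e^p)·(2e)^k: the combination describing J(p+1, ·).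
rescale : ℕ → Combo → Combo
rescale p []            = []
rescale p ((b , e) ∷ A) = (b * e ^ℚ p , two * e) ∷ rescale p A

eval-rescale : ∀ p k A → two ^ℚ k * eval Pow A (p ℕ.+ k) ≡ eval Pow (rescale p A) k
eval-rescale p k []            = ℚₚ.*-zeroʳ (two ^ℚ k)
eval-rescale p k ((b , e) ∷ A) =
  trans (ℚₚ.*-distribˡ-+ (two ^ℚ k) (b * e ^ℚ (p ℕ.+ k)) (eval Pow A (p ℕ.+ k)))
        (cong₂ _+_ term (eval-rescale p k A))
  where
  term : two ^ℚ k * (b * e ^ℚ (p ℕ.+ k)) ≡ b * e ^ℚ p * (two * e) ^ℚ k
  term = begin
    two ^ℚ k * (b * e ^ℚ (p ℕ.+ k))        ≡⟨ cong (λ z → two ^ℚ k * (b * z)) (^-+ e p k) ⟩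
    two ^ℚ k * (b * (e ^ℚ p * e ^ℚ k))     ≡⟨ solve 4 (λ t b q x → t :* (b :* (q :* x)) := b :* q :* (t :* x)) refl
                                                (two ^ℚ k) b (e ^ℚ p) (e ^ℚ k) ⟩
    b * e ^ℚ p * (two ^ℚ k * e ^ℚ k)       ≡⟨ cong (b * e ^ℚ p *_) (^-* two e k) ⟩
    b * e ^ℚ p * (two * e) ^ℚ k            ∎

J-closedForm : ∀ {p A} → ClosedForm p A → Jseries (suc p) ≗ₛ eval Pow (rescale p A)
J-closedForm {p} {A} cf k = begin
  ℕ→ℚ (2 ℕ.^ k) * ℕ→ℚ ((p ℕ.+ k) !) * I (suc p) k
    ≡⟨ cong₂ (λ x y → x * ℕ→ℚ ((p ℕ.+ k) !) * y) (ℕ→ℚ-2^ k) (ClosedForm.values cf k) ⟩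
  two ^ℚ k * ℕ→ℚ ((p ℕ.+ k) !) * eval E A (p ℕ.+ k)
    ≡⟨ ℚₚ.*-assoc (two ^ℚ k) _ _ ⟩
  two ^ℚ k * (ℕ→ℚ ((p ℕ.+ k) !) * eval E A (p ℕ.+ k))
    ≡⟨ cong (two ^ℚ k *_) (eval-factorial A (p ℕ.+ k)) ⟩
  two ^ℚ k * eval Pow A (p ℕ.+ k)
    ≡⟨ eval-rescale p k A ⟩
  eval Pow (rescale p A) k ∎

mulPoly : List ℚ → Series → Series
mulPoly []       F m       = 0ℚ
mulPoly (c ∷ cs) F zero    = c * F zero + 0ℚ
mulPoly (c ∷ cs) F (suc m) = c * F (suc m) + mulPoly cs F m

⊛-poly : ∀ cs F → poly cs ⊛ F ≗ₛ mulPoly cs F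
⊛-poly cs F m = trans (⊛-sumFrom (poly cs) F m) (sum cs m)
  where
  sum : ∀ cs m → sumFrom (λ i → poly cs i * F (m ∸ i)) (suc m) 0 ≡ mulPoly cs F m
  sum []       m       = trans (sumFrom-cong′ (suc m) 0 (λ i → ℚₚ.*-zeroˡ (F (m ∸ i)))) (sumFrom-zero (suc m) 0)
  sum (c ∷ cs) zero    = refl
  sum (c ∷ cs) (suc m) = cong (_+_ (c * F (suc m)))
    (trans (sumFrom-shift (λ i → poly (c ∷ cs) i * F (suc m ∸ i)) (suc m) 0) (sum cs m))

infixl 6 _+ₚ_
_+ₚ_ : List ℚ → List ℚ → List ℚ
[]       +ₚ ys       = ys
(x ∷ xs) +ₚ []       = x ∷ xs
(x ∷ xs) +ₚ (y ∷ ys) = (x + y) ∷ (xs +ₚ ys)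

poly-+ₚ : ∀ xs ys m → poly (xs +ₚ ys) m ≡ poly xs m + poly ys m
poly-+ₚ []       ys       m       = sym (ℚₚ.+-identityˡ _)
poly-+ₚ (x ∷ xs) []       m       = sym (ℚₚ.+-identityʳ _)
poly-+ₚ (x ∷ xs) (y ∷ ys) zero    = refl
poly-+ₚ (x ∷ xs) (y ∷ ys) (suc m) = poly-+ₚ xs ys m

scaleₚ : ℚ → List ℚ → List ℚ
scaleₚ c []       = []
scaleₚ c (d ∷ ds) = c * d ∷ scaleₚ c ds

poly-scaleₚ : ∀ c ds m → poly (scaleₚ c ds) m ≡ c * poly ds m
poly-scaleₚ c []       m       = sym (ℚₚ.*-zeroʳ c)
poly-scaleₚ c (d ∷ ds) zero    = refl
poly-scaleₚ c (d ∷ ds) (suc m) = poly-scaleₚ c ds m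

infixl 7 _·ₚ_
_·ₚ_ : List ℚ → List ℚ → List ℚ
[]       ·ₚ ds = []
(c ∷ cs) ·ₚ ds = scaleₚ c ds +ₚ (0ℚ ∷ (cs ·ₚ ds))

⊛-poly-poly : ∀ cs ds → poly cs ⊛ poly ds ≗ₛ poly (cs ·ₚ ds)
⊛-poly-poly cs ds m = trans (⊛-poly cs (poly ds) m) (product cs m)
  where
  product : ∀ cs m → mulPoly cs (poly ds) m ≡ poly (cs ·ₚ ds) m
  product []       m       = refl
  product (c ∷ cs) zero    =
    sym (trans (poly-+ₚ (scaleₚ c ds) (0ℚ ∷ (cs ·ₚ ds)) 0) (cong (_+ 0ℚ) (poly-scaleₚ c ds 0)))
  product (c ∷ cs) (suc m) =
    sym (trans (poly-+ₚ (scaleₚ c ds) (0ℚ ∷ (cs ·ₚ ds)) (suc m))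
               (cong₂ _+_ (poly-scaleₚ c ds (suc m)) (sym (product cs m))))

linear : ℚ → List ℚ
linear e = 1ℚ ∷ - e ∷ []

denominator : ℚ → List ℚ → List ℚ
denominator e es = foldl (λ q f → q ·ₚ linear f) (linear e) es

product-of-factors : ∀ e es → foldl (λ S f → S ⊛ 1- f x) (1- e x) es ≗ₛ poly (denominator e es)
product-of-factors e es = go es (1- e x) (linear e) (λ m → refl)
  where
  go : ∀ es S q → S ≗ₛ poly q →
       foldl (λ S f → S ⊛ 1- f x) S es ≗ₛ poly (foldl (λ q f → q ·ₚ linear f) q es)
  go []       S q S≗q = S≗q
  go (f ∷ es) S q S≗q = go es (S ⊛ 1- f x) (q ·ₚ linear f)
    (λ m → trans (⊛-congˡ (1- f x) S≗q m) (⊛-poly-poly q (linear f) m))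

deriveⁿ : ℕ → Combo → Combo
deriveⁿ zero    A = A
deriveⁿ (suc j) A = deriveⁿ j (derive A)

eval-Pow-+ : ∀ j A k → eval Pow A (j ℕ.+ k) ≡ eval Pow (deriveⁿ j A) k
eval-Pow-+ zero    A k = refl
eval-Pow-+ (suc j) A k = trans (shift A (j ℕ.+ k)) (eval-Pow-+ j (derive A) k)
  where
  shift : ∀ A k → eval Pow A (suc k) ≡ eval Pow (derive A) k
  shift []            k = refl
  shift ((b , e) ∷ A) k = cong₂ _+_ (sym (ℚₚ.*-assoc b e (e ^ℚ k))) (shift A k)

degree : List ℚ → ℕ
degree []       = 0
degree (_ ∷ cs) = length cs

-- The coefficients of Q·A beyond degree Q, as one geometric combination.
annihilator : List ℚ → Combo → Combo
annihilator []       A = []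
annihilator (c ∷ cs) A = scale c (deriveⁿ (length cs) A) ++ annihilator cs A

eval-annihilator : ∀ Q A m → mulPoly Q (eval Pow A) (degree Q ℕ.+ m) ≡ eval Pow (annihilator Q A) m
eval-annihilator []            A m       = refl
eval-annihilator (c ∷ [])      A zero    = sym (eval-scale-++ Pow c A [] 0)
eval-annihilator (c ∷ [])      A (suc m) = sym (eval-scale-++ Pow c A [] (suc m))
eval-annihilator (c ∷ c′ ∷ cs) A m       =
  trans (cong₂ (λ x y → c * x + y) (eval-Pow-+ (suc (length cs)) A m) (eval-annihilator (c′ ∷ cs) A m))
        (sym (eval-scale-++ Pow c (deriveⁿ (suc (length cs)) A) (annihilator (c′ ∷ cs) A) m))

prefix : Series → ℕ → List ℚ
prefix F zero    = []
prefix F (suc d) = F 0 ∷ prefix (λ m → F (suc m)) d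

≗ₛ-split : ∀ d F G → prefix F d ≡ prefix G d → (∀ m → F (d ℕ.+ m) ≡ G (d ℕ.+ m)) → F ≗ₛ G
≗ₛ-split zero    F G _    tail m       = tail m
≗ₛ-split (suc d) F G head tail zero    = ∷-injectiveˡ head
≗ₛ-split (suc d) F G head tail (suc m) =
  ≗ₛ-split d (λ m → F (suc m)) (λ m → G (suc m)) (∷-injectiveʳ head) tail m

poly-drop : ∀ d ns m → poly ns (d ℕ.+ m) ≡ poly (drop d ns) m
poly-drop zero    ns       m = refl
poly-drop (suc d) []       m = refl
poly-drop (suc d) (n ∷ ns) m = poly-drop d ns m

rational-gf : ∀ Q N A F → F ≗ₛ eval Pow A →
  normalize (annihilator Q A) ≡ [] → drop (degree Q) N ≡ [] →
  prefix (poly Q ⊛ eval Pow A) (degree Q) ≡ prefix (poly N) (degree Q) →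
  poly Q ⊛ F ≗ₛ poly N
rational-gf Q N A F F≗A annihilates low initial m =
  trans (⊛-congʳ (poly Q) F≗A m) (≗ₛ-split (degree Q) (poly Q ⊛ eval Pow A) (poly N) initial tail m)
  where
  tail : ∀ m → (poly Q ⊛ eval Pow A) (degree Q ℕ.+ m) ≡ poly N (degree Q ℕ.+ m)
  tail m = begin
    (poly Q ⊛ eval Pow A) (degree Q ℕ.+ m)  ≡⟨ ⊛-poly Q (eval Pow A) (degree Q ℕ.+ m) ⟩
    mulPoly Q (eval Pow A) (degree Q ℕ.+ m) ≡⟨ eval-annihilator Q A m ⟩
    eval Pow (annihilator Q A) m            ≡⟨ eval-normalize Pow (annihilator Q A) [] annihilates m ⟩
    0ℚ                                      ≡⟨ cong (λ ns → poly ns m) low ⟨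
    poly (drop (degree Q) N) m              ≡⟨ poly-drop (degree Q) N m ⟨
    poly N (degree Q ℕ.+ m)                 ∎

J-generatingFunction : ∀ {p A} → ClosedForm p A → ∀ e es N →
  normalize (annihilator (denominator e es) (rescale p A)) ≡ [] →
  drop (degree (denominator e es)) N ≡ [] →
  prefix (poly (denominator e es) ⊛ eval Pow (rescale p A)) (degree (denominator e es))
    ≡ prefix (poly N) (degree (denominator e es)) →
  foldl (λ S f → S ⊛ 1- f x) (1- e x) es ⊛ Jseries (suc p) ≗ₛ poly N
J-generatingFunction {p} {A} cf e es N annihilates low initial m =
  trans (⊛-congˡ (Jseries (suc p)) (product-of-factors e es) m)
        (rational-gf (denominator e es) N (rescale p A) (Jseries (suc p)) (J-closedForm cf)
           annihilates low initial m)

half : ℚ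
half = (+ 1) / 2

formula : ℕ → Combo
formula 1 = (1ℚ , half) ∷ []
formula 2 = (half , ℕ→ℚ 2) ∷ (- half , 1ℚ) ∷ []
formula 3 = (- half , (+ 5) / 2) ∷ ((+ 1) / 3 , (+ 3) / 2) ∷ ((+ 1) / 6 , (+ 9) / 2) ∷ []
formula 4 = ((+ 1) / 24 , ℕ→ℚ 8) ∷ (half , ℕ→ℚ 3) ∷ (- ((+ 1) / 6) , ℕ→ℚ 5)
          ∷ (- ((+ 1) / 4) , ℕ→ℚ 2) ∷ (- ((+ 1) / 8) , ℕ→ℚ 4) ∷ []
formula _ = []

-- The recursion identities for n = 1, …, 4 hold by computing normal forms.
closed₁ : ClosedForm 0 (formula 1)
closed₁ = closedForm-one (formula 1) refl refl

closed₂ : ClosedForm 1 (formula 2)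
closed₂ = closedForm 0 formula
  (λ { zero _ → closed₁ ; (suc p) () })
  (λ { zero _ → refl ; (suc r) (s≤s ()) })
  refl

closed₃ : ClosedForm 2 (formula 3)
closed₃ = closedForm 1 formula
  (λ { zero _ → closed₁ ; (suc zero) _ → closed₂ ; (suc (suc p)) (s≤s ()) })
  (λ { zero _ → refl ; (suc zero) _ → refl ; (suc (suc r)) (s≤s (s≤s ())) })
  refl

closed₄ : ClosedForm 3 (formula 4)
closed₄ = closedForm 2 formula
  (λ { zero _ → closed₁ ; (suc zero) _ → closed₂ ; (suc (suc zero)) _ → closed₃
     ; (suc (suc (suc p))) (s≤s (s≤s ())) })
  (λ { zero _ → refl ; (suc zero) _ → refl ; (suc (suc zero)) _ → refl
     ; (suc (suc (suc r))) (s≤s (s≤s (s≤s ()))) })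
  refl

J₁ : ∀ k → J 1 k ≡ 1ℚ
J₁ k = trans (J-closedForm closed₁ k)
  (trans (ℚₚ.+-identityʳ _) (trans (ℚₚ.*-identityˡ _) (1^ k)))

J₂ : ∀ k → J 2 k ≡ ((+ 4) / 1) ^ℚ k - ((+ 1) / 2) * (((+ 2) / 1) ^ℚ k)
J₂ k = trans (J-closedForm closed₂ k)
  (solve 2 (λ a b → con 1ℚ :* a :+ (con (- half) :* b :+ con 0ℚ) := a :- con half :* b) refl
     (((+ 4) / 1) ^ℚ k) (((+ 2) / 1) ^ℚ k))

J₃ : ∀ k → J 3 k ≡ (- ((+ 25) / 8)) * (((+ 5) / 1) ^ℚ k)
                  + ((+ 3) / 4) * (((+ 3) / 1) ^ℚ k)
                  + ((+ 27) / 8) * (((+ 9) / 1) ^ℚ k)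
J₃ k = trans (J-closedForm closed₃ k)
  (solve 3 (λ a b c → con (- ((+ 25) / 8)) :* a :+ (con ((+ 3) / 4) :* b :+ (con ((+ 27) / 8) :* c :+ con 0ℚ))
                    := con (- ((+ 25) / 8)) :* a :+ con ((+ 3) / 4) :* b :+ con ((+ 27) / 8) :* c) refl
     (((+ 5) / 1) ^ℚ k) (((+ 3) / 1) ^ℚ k) (((+ 9) / 1) ^ℚ k))

J₄ : ∀ k → J 4 k ≡ ((+ 64) / 3) * (((+ 16) / 1) ^ℚ k)
                  + ((+ 27) / 2) * (((+ 6) / 1) ^ℚ k)
                  - ((+ 250) / 12) * (((+ 10) / 1) ^ℚ k)
                  - ((+ 2) / 1) * (((+ 4) / 1) ^ℚ k)
                  - ((+ 8) / 1) * (((+ 8) / 1) ^ℚ k)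
J₄ k = trans (J-closedForm closed₄ k)
  (solve 5 (λ a b c d e →
      con ((+ 64) / 3) :* a :+ (con ((+ 27) / 2) :* b :+ (con (- ((+ 250) / 12)) :* c
        :+ (con (- ((+ 2) / 1)) :* d :+ (con (- ((+ 8) / 1)) :* e :+ con 0ℚ))))
      := con ((+ 64) / 3) :* a :+ con ((+ 27) / 2) :* b :- con ((+ 250) / 12) :* c
           :- con ((+ 2) / 1) :* d :- con ((+ 8) / 1) :* e) refl
     (((+ 16) / 1) ^ℚ k) (((+ 6) / 1) ^ℚ k) (((+ 10) / 1) ^ℚ k) (((+ 4) / 1) ^ℚ k) (((+ 8) / 1) ^ℚ k))

theorem4 : ((k : ℕ) → J 1 k ≡ 1ℚ)
    × ((1- ((+ 1) / 1) x) ⊛ Jseries 1 ≗ₛ poly (1ℚ ∷ []))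
    × ((k : ℕ) → J 2 k ≡ ((+ 4) / 1) ^ℚ k - ((+ 1) / 2) * (((+ 2) / 1) ^ℚ k))
    × (((1- ((+ 2) / 1) x) ⊛ (1- ((+ 4) / 1) x)) ⊛ Jseries 2 ≗ₛ poly (((+ 1) / 2) ∷ []))
    × ((k : ℕ) → J 3 k ≡ (- ((+ 25) / 8)) * (((+ 5) / 1) ^ℚ k)
                          + ((+ 3) / 4) * (((+ 3) / 1) ^ℚ k)
                          + ((+ 27) / 8) * (((+ 9) / 1) ^ℚ k))
    × ((((1- ((+ 3) / 1) x) ⊛ (1- ((+ 5) / 1) x)) ⊛ (1- ((+ 9) / 1) x)) ⊛ Jseries 3
         ≗ₛ poly (1ℚ ∷ []))
    × ((k : ℕ) → J 4 k ≡ ((+ 64) / 3) * (((+ 16) / 1) ^ℚ k)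
                          + ((+ 27) / 2) * (((+ 6) / 1) ^ℚ k)
                          - ((+ 250) / 12) * (((+ 10) / 1) ^ℚ k)
                          - ((+ 2) / 1) * (((+ 4) / 1) ^ℚ k)
                          - ((+ 8) / 1) * (((+ 8) / 1) ^ℚ k))
    × (1- ((+ 4) / 1) x ⊛ 1- ((+ 6) / 1) x ⊛ 1- ((+ 8) / 1) x
          ⊛ 1- ((+ 10) / 1) x ⊛ 1- ((+ 16) / 1) x ⊛ Jseries 4
         ≗ₛ poly (((+ 4) / 1) ∷ (- ((+ 34) / 1)) ∷ []))
theorem4 =
    J₁ , J-generatingFunction closed₁ ((+ 1) / 1) [] (1ℚ ∷ []) refl refl refl
  , J₂ , J-generatingFunction closed₂ ((+ 2) / 1) ((+ 4) / 1 ∷ []) (half ∷ []) refl refl refl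
  , J₃ , J-generatingFunction closed₃ ((+ 3) / 1) ((+ 5) / 1 ∷ (+ 9) / 1 ∷ []) (1ℚ ∷ [])
           refl refl refl
  , J₄ , J-generatingFunction closed₄ ((+ 4) / 1)
           ((+ 6) / 1 ∷ (+ 8) / 1 ∷ (+ 10) / 1 ∷ (+ 16) / 1 ∷ []) ((+ 4) / 1 ∷ - ((+ 34) / 1) ∷ [])
           refl refl refl
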